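{- Let $u\in\mathsf{O}$ be a unit ($N(u)=1$) and $s\in\mathsf{O}$ with $N(s)=2$. Then $$u(\mathsf{O}s)=\mathsf{O}(\overline{u}s),\quad (\mathsf{O}s)u=\mathsf{O}(usu),\quad u(\mathsf{O}s)u=\mathsf{O}(su),$$ $$u(s\mathsf{O})=(usu)\mathsf{O},\quad (s\mathsf{O})u=(s\overline{u})\mathsf{O},\quad u(s\mathsf{O})u=(us)\mathsf{O}.$$ Equivalently, $\mathtt{L}_u(\mathsf{O}s)=\mathsf{O}\,\mathtt{L}_{\overline{u}}(s)$, $\mathtt{R}_u(\mathsf{O}s)=\mathsf{O}\,\mathtt{B}_u(s)$, $\mathtt{B}_u(\mathsf{O}s)=\mathsf{O}\,\mathtt{R}_u(s)$, $\mathtt{L}_u(s\mathsf{O})=\mathtt{B}_u(s)\,\mathsf{O}$, $\mathtt{R}_u(s\mathsf{O})=\mathtt{R}_{\overline{u}}(s)\,\mathsf{O}$, $\mathtt{B}_u(s\mathsf{O})=\mathtt{L}_u(s)\,\mathsf{O}$.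
   Context: $\mathbb{O}$ is the real octonion algebra with norm $N(x)=x\overline{x}$. Fix a basic triple $(i,j,l)$ (imaginary units with $i\perp j$, $l\perp 1,i,j,ij$), set $i_0=-(ij)l$, $i_1=il$, $i_2=i$, $i_3=j$, $i_4=l$, $i_5=ij$, $i_6=jl$, and $\omega_r=\frac12(-1+i_0+i_r+i_{3r})$ for $r\in\{1,2,4\}$ (indices mod 7); $\mathsf{O}$ is the subring of $\mathbb{O}$ generated by $\omega_1,\omega_2,\omega_4$ (the octavian integers). For $S\subseteq\mathsf{O}$, $uS=\{ux:x\in S\}$, $Su=\{xu\}$, $uSu=\{uxu\}$ (note $uxu$ is unambiguous by alternativity), $\mathsf{O}s=\{xs:x\in\mathsf{O}\}$, $s\mathsf{O}=\{sx:x\in\mathsf{O}\}$. The translation maps are $\mathtt{L}_x(y)=xy$, $\mathtt{R}_x(y)=yx$, $\mathtt{B}_x(y)=xyx$. -}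

module Defs where

open import Data.Rational using (ℚ; 0ℚ; 1ℚ; ½) renaming (_+_ to _+q_; _*_ to _*q_; -_ to -q_)
open import Data.Product using (Σ; _×_; _,_)
open import Relation.Binary.PropositionalEquality using (_≡_)

-- Real octonions are modelled by their rational points, built by the
-- Cayley–Dickson construction:  (a,b)(c,d) = (ac − d̄b , da + bc̄),
-- conj (a,b) = (ā , −b).  Every element of the octavian integers has
-- rational coordinates, so nothing is lost.

record ℂq : Set where
  constructor _,ᶜ_
  field re im : ℚ

record ℍq : Set where
  constructor _,ʰ_
  field h₁ h₂ : ℂq

record 𝕆 : Set where
  constructor _,ᵒ_
  field o₁ o₂ : ℍq

infixl 6 _+ᶜ_
infixl 7 _*ᶜ_
_+ᶜ_ : ℂq → ℂq → ℂq
(a ,ᶜ b) +ᶜ (c ,ᶜ d) = (a +q c) ,ᶜ (b +q d)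
-ᶜ_ : ℂq → ℂq
-ᶜ (a ,ᶜ b) = (-q a) ,ᶜ (-q b)
conjᶜ : ℂq → ℂq
conjᶜ (a ,ᶜ b) = a ,ᶜ (-q b)
_*ᶜ_ : ℂq → ℂq → ℂq
(a ,ᶜ b) *ᶜ (c ,ᶜ d) = ((a *q c) +q (-q (d *q b))) ,ᶜ ((d *q a) +q (b *q c))
0ᶜ 1ᶜ : ℂq
0ᶜ = 0ℚ ,ᶜ 0ℚ
1ᶜ = 1ℚ ,ᶜ 0ℚ

_+ʰ_ : ℍq → ℍq → ℍq
(a ,ʰ b) +ʰ (c ,ʰ d) = (a +ᶜ c) ,ʰ (b +ᶜ d)
-ʰ_ : ℍq → ℍq
-ʰ (a ,ʰ b) = (-ᶜ a) ,ʰ (-ᶜ b)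
conjʰ : ℍq → ℍq
conjʰ (a ,ʰ b) = conjᶜ a ,ʰ (-ᶜ b)
_*ʰ_ : ℍq → ℍq → ℍq
(a ,ʰ b) *ʰ (c ,ʰ d) = ((a *ᶜ c) +ᶜ (-ᶜ (conjᶜ d *ᶜ b))) ,ʰ ((d *ᶜ a) +ᶜ (b *ᶜ conjᶜ c))
0ʰ 1ʰ : ℍq
0ʰ = 0ᶜ ,ʰ 0ᶜ
1ʰ = 1ᶜ ,ʰ 0ᶜ

infixl 6 _+_
infixl 7 _*_
_+_ : 𝕆 → 𝕆 → 𝕆
(a ,ᵒ b) + (c ,ᵒ d) = (a +ʰ c) ,ᵒ (b +ʰ d)
-_ : 𝕆 → 𝕆
- (a ,ᵒ b) = (-ʰ a) ,ᵒ (-ʰ b)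
conj : 𝕆 → 𝕆
conj (a ,ᵒ b) = conjʰ a ,ᵒ (-ʰ b)
_*_ : 𝕆 → 𝕆 → 𝕆
(a ,ᵒ b) * (c ,ᵒ d) = ((a *ʰ c) +ʰ (-ʰ (conjʰ d *ʰ b))) ,ᵒ ((d *ʰ a) +ʰ (b *ʰ conjʰ c))

scale : ℚ → 𝕆 → 𝕆
scale r (((a ,ᶜ b) ,ʰ (c ,ᶜ d)) ,ᵒ ((e ,ᶜ f) ,ʰ (g ,ᶜ h))) =
  (((r *q a) ,ᶜ (r *q b)) ,ʰ ((r *q c) ,ᶜ (r *q d))) ,ᵒ (((r *q e) ,ᶜ (r *q f)) ,ʰ ((r *q g) ,ᶜ (r *q h)))

one : 𝕆
one = 1ʰ ,ᵒ 0ʰ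

-- norm N(x) = x x̄ (an element of the real line ℝ·1 ⊂ 𝕆)
N : 𝕆 → 𝕆
N x = x * conj x

two : 𝕆
two = one + one

L R B : 𝕆 → 𝕆 → 𝕆
L x y = x * y
R x y = y * x
B x y = (x * y) * x   -- unambiguous by alternativity

i j l : 𝕆
i = ((0ℚ ,ᶜ 1ℚ) ,ʰ 0ᶜ) ,ᵒ 0ʰ
j = (0ᶜ ,ʰ 1ᶜ) ,ᵒ 0ʰ
l = 0ʰ ,ᵒ 1ʰ

i0 i1 i2 i3 i4 i5 i6 : 𝕆
i0 = - ((i * j) * l)
i1 = i * l
i2 = i
i3 = j
i4 = l
i5 = i * j
i6 = j * l

-- ω_r = ½(−1 + i₀ + i_r + i_{3r}), r ∈ {1,2,4} (indices mod 7)
ω₁ ω₂ ω₄ : 𝕆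
ω₁ = scale ½ (- one + i0 + i1 + i3)
ω₂ = scale ½ (- one + i0 + i2 + i6)
ω₄ = scale ½ (- one + i0 + i4 + i5)

data InO : 𝕆 → Set where
  gen₁ : InO ω₁
  gen₂ : InO ω₂
  gen₄ : InO ω₄
  one∈ : InO one
  add∈ : ∀ {x y} → InO x → InO y → InO (x + y)
  neg∈ : ∀ {x} → InO x → InO (- x)
  mul∈ : ∀ {x y} → InO x → InO y → InO (x * y)

Subset : Set₁
Subset = 𝕆 → Set

_≐_ : Subset → Subset → Set
A ≐ C = ∀ x → ((A x → C x) × (C x → A x))

image : (𝕆 → 𝕆) → Subset → Subset
image f A x = Σ 𝕆 (λ y → A y × (f y ≡ x))

Os : 𝕆 → Subset
Os s = image (λ x → x * s) InO
sO : 𝕆 → Subset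
sO s = image (λ x → s * x) InO

module Submission where

open import Defs
open import Data.Fin using (Fin; #_; combine)
open import Data.Nat using (ℕ) renaming (_*_ to _*ℕ_)
open import Data.Product using (_×_; _,_; proj₁; proj₂)
open import Data.Rational using (ℚ; 0ℚ; 1ℚ)
open import Data.Rational.Properties using (+-*-commutativeRing) renaming (_≟_ to _≟ℚ_)
open import Data.Vec using (Vec; []; _∷_; map; concat; tabulate; replicate)
open import Data.Vec.Properties using (∷-injectiveˡ; ∷-injectiveʳ)
open import Function using (id)
open import Level using (0ℓ) renaming (suc to lsuc)
open import Relation.Binary.Bundles using (Setoid)
open import Relation.Binary.PropositionalEquality
open import Relation.Nullary.Decidable using (dec⇒maybe)
import Tactic.RingSolver.Core.AlmostCommutativeRing as ACR
import Tactic.RingSolver.NonReflective as RingSolver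
open import Algebra.Definitions {A = 𝕆} _≡_
  using (LeftIdentity; RightIdentity; Flexible; LeftBol; RightBol)

-- Octonion multiplication is flexible and satisfies the Bol (Moufang)
-- identities, and a unit u of 𝖮 has its inverse ū = conj u in 𝖮.  For a left
-- or right translation T, the map x ↦ T(xs) (resp. x ↦ T(sx)) factors as a
-- bijection of 𝖮 (a translation by u or ū) followed by multiplication with
-- the new generator; e.g. u(xs) = ((ux)u)(ūs) by the left Bol identity.
-- Since B u = R u ∘ L u, the two statements about B follow by composition.

ℚ-ring : ACR.AlmostCommutativeRing _ _
ℚ-ring = ACR.fromCommutativeRing +-*-commutativeRing (λ x → dec⇒maybe (0ℚ ≟ℚ x))

open RingSolver ℚ-ring using (Expr; Κ; Ι; _⊕_; _⊗_; ⊝_)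
open RingSolver.Ops ℚ-ring using (⟦_⟧; ⟦_⇓⟧; correct)

record StarOps (A : Set) : Set where
  field
    add mul : A → A → A
    neg star : A → A

-- The formulas are those used in Defs for ℂq, ℍq and 𝕆 alike.
cayleyDickson : ∀ {A} → StarOps A → StarOps (A × A)
cayleyDickson ops = record
  { add  = λ (a , b) (c , d) → add a c , add b d
  ; mul  = λ (a , b) (c , d) → add (mul a c) (neg (mul (star d) b)) , add (mul d a) (mul b (star c))
  ; neg  = λ (a , b) → neg a , neg b
  ; star = λ (a , b) → star a , neg b
  }
  where open StarOps ops

Oct : Set → Set
Oct A = ((A × A) × (A × A)) × ((A × A) × (A × A))

Term : ℕ → Set
Term k = Oct (Expr ℚ (k *ℕ 8))

termOps : ∀ {n} → StarOps (Oct (Expr ℚ n))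
termOps = cayleyDickson (cayleyDickson (cayleyDickson
  record { add = _⊕_ ; mul = _⊗_ ; neg = ⊝_ ; star = id }))

open module TermOps {n} = StarOps (termOps {n})
  renaming (add to infixl 6 _+ₜ_; mul to infixl 7 _*ₜ_; neg to -ₜ_; star to conjₜ)

module _ {A : Set} where
  flatten : Oct A → Vec A 8
  flatten (((a , b) , (c , d)) , ((e , f) , (g , h))) = a ∷ b ∷ c ∷ d ∷ e ∷ f ∷ g ∷ h ∷ []

  unflatten : Vec A 8 → Oct A
  unflatten (a ∷ b ∷ c ∷ d ∷ e ∷ f ∷ g ∷ h ∷ []) = ((a , b) , (c , d)) , ((e , f) , (g , h))

oneₜ : ∀ {n} → Oct (Expr ℚ n)
oneₜ = unflatten (Κ 1ℚ ∷ replicate 7 (Κ 0ℚ))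

toVec : 𝕆 → Vec ℚ 8
toVec (((a ,ᶜ b) ,ʰ (c ,ᶜ d)) ,ᵒ ((e ,ᶜ f) ,ʰ (g ,ᶜ h))) = a ∷ b ∷ c ∷ d ∷ e ∷ f ∷ g ∷ h ∷ []

fromVec : Vec ℚ 8 → 𝕆
fromVec (a ∷ b ∷ c ∷ d ∷ e ∷ f ∷ g ∷ h ∷ []) = ((a ,ᶜ b) ,ʰ (c ,ᶜ d)) ,ᵒ ((e ,ᶜ f) ,ʰ (g ,ᶜ h))

-- The i-th octonion variable occupies coordinates 8i, …, 8i+7.
var : ∀ k → Fin k → Term k
var k i = unflatten (tabulate (λ c → Ι (combine i c)))

coordinates : ∀ {k} → Vec 𝕆 k → Vec ℚ (k *ℕ 8)
coordinates xs = concat (map toVec xs)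

⟦_⟧[_] : ∀ {k} → Term k → Vec 𝕆 k → 𝕆
⟦ t ⟧[ xs ] = fromVec (map (λ e → ⟦ e ⟧ (coordinates xs)) (flatten t))

_≈[_]_ : ∀ {n} → Oct (Expr ℚ n) → Vec ℚ n → Oct (Expr ℚ n) → Set
t ≈[ ρ ] t′ = map (λ e → ⟦ e ⇓⟧ ρ) (flatten t) ≡ map (λ e → ⟦ e ⇓⟧ ρ) (flatten t′)

⟦⟧-cong-⇓ : ∀ {n} ρ (a b : Expr ℚ n) → ⟦ a ⇓⟧ ρ ≡ ⟦ b ⇓⟧ ρ → ⟦ a ⟧ ρ ≡ ⟦ b ⟧ ρ
⟦⟧-cong-⇓ ρ a b eq = trans (sym (correct a ρ)) (trans eq (correct b ρ))

map-⟦⟧-cong-⇓ : ∀ {n m} ρ (as bs : Vec (Expr ℚ n) m) →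
                map (λ e → ⟦ e ⇓⟧ ρ) as ≡ map (λ e → ⟦ e ⇓⟧ ρ) bs →
                map (λ e → ⟦ e ⟧ ρ) as ≡ map (λ e → ⟦ e ⟧ ρ) bs
map-⟦⟧-cong-⇓ ρ []       []       _  = refl
map-⟦⟧-cong-⇓ ρ (a ∷ as) (b ∷ bs) eq =
  cong₂ _∷_ (⟦⟧-cong-⇓ ρ a b (∷-injectiveˡ eq)) (map-⟦⟧-cong-⇓ ρ as bs (∷-injectiveʳ eq))

-- At a use site the hypothesis is proved by refl, which succeeds exactly when
-- the two sides have the same ring normal form in every coordinate.
solve : ∀ {k} (t t′ : Term k) (xs : Vec 𝕆 k) → t ≈[ coordinates xs ] t′ → ⟦ t ⟧[ xs ] ≡ ⟦ t′ ⟧[ xs ]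
solve t t′ xs eq = cong fromVec (map-⟦⟧-cong-⇓ (coordinates xs) (flatten t) (flatten t′) eq)

solve₁ : (t t′ : Term 1 → Term 1) (x : 𝕆) →
         t (var 1 (# 0)) ≈[ coordinates (x ∷ []) ] t′ (var 1 (# 0)) →
         ⟦ t (var 1 (# 0)) ⟧[ x ∷ [] ] ≡ ⟦ t′ (var 1 (# 0)) ⟧[ x ∷ [] ]
solve₁ t t′ x = solve (t (var 1 (# 0))) (t′ (var 1 (# 0))) (x ∷ [])

solve₂ : (t t′ : Term 2 → Term 2 → Term 2) (x y : 𝕆) →
         t (var 2 (# 0)) (var 2 (# 1)) ≈[ coordinates (x ∷ y ∷ []) ] t′ (var 2 (# 0)) (var 2 (# 1)) →
         ⟦ t (var 2 (# 0)) (var 2 (# 1)) ⟧[ x ∷ y ∷ [] ] ≡ ⟦ t′ (var 2 (# 0)) (var 2 (# 1)) ⟧[ x ∷ y ∷ [] ]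
solve₂ t t′ x y = solve (t (var 2 (# 0)) (var 2 (# 1))) (t′ (var 2 (# 0)) (var 2 (# 1))) (x ∷ y ∷ [])

solve₃ : (t t′ : Term 3 → Term 3 → Term 3 → Term 3) (x y z : 𝕆) →
         t (var 3 (# 0)) (var 3 (# 1)) (var 3 (# 2))
           ≈[ coordinates (x ∷ y ∷ z ∷ []) ] t′ (var 3 (# 0)) (var 3 (# 1)) (var 3 (# 2)) →
         ⟦ t (var 3 (# 0)) (var 3 (# 1)) (var 3 (# 2)) ⟧[ x ∷ y ∷ z ∷ [] ]
           ≡ ⟦ t′ (var 3 (# 0)) (var 3 (# 1)) (var 3 (# 2)) ⟧[ x ∷ y ∷ z ∷ [] ]
solve₃ t t′ x y z =
  solve (t (var 3 (# 0)) (var 3 (# 1)) (var 3 (# 2))) (t′ (var 3 (# 0)) (var 3 (# 1)) (var 3 (# 2))) (x ∷ y ∷ z ∷ [])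

*-flexible : Flexible _*_
*-flexible x y = solve₂ (λ X Y → (X *ₜ Y) *ₜ X) (λ X Y → X *ₜ (Y *ₜ X)) x y refl

*-identityˡ : LeftIdentity one _*_
*-identityˡ x = solve₁ (λ X → oneₜ *ₜ X) (λ X → X) x refl

*-identityʳ : RightIdentity one _*_
*-identityʳ x = solve₁ (λ X → X *ₜ oneₜ) (λ X → X) x refl

*-leftBol : LeftBol _*_
*-leftBol x y z = solve₃ (λ X Y Z → X *ₜ (Y *ₜ (X *ₜ Z))) (λ X Y Z → (X *ₜ (Y *ₜ X)) *ₜ Z) x y z refl

*-rightBol : RightBol _*_
*-rightBol x y z = solve₃ (λ X Y Z → ((Z *ₜ X) *ₜ Y) *ₜ X) (λ X Y Z → Z *ₜ ((X *ₜ Y) *ₜ X)) x y z refl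

L-L-conj : ∀ x y → L x (L (conj x) y) ≡ N x * y
L-L-conj x y = solve₂ (λ X Y → X *ₜ (conjₜ X *ₜ Y)) (λ X Y → (X *ₜ conjₜ X) *ₜ Y) x y refl

L-conj-L : ∀ x y → L (conj x) (L x y) ≡ N x * y
L-conj-L x y = solve₂ (λ X Y → conjₜ X *ₜ (X *ₜ Y)) (λ X Y → (X *ₜ conjₜ X) *ₜ Y) x y refl

R-R-conj : ∀ x y → R x (R (conj x) y) ≡ y * N x
R-R-conj x y = solve₂ (λ X Y → (Y *ₜ conjₜ X) *ₜ X) (λ X Y → Y *ₜ (X *ₜ conjₜ X)) x y refl

R-conj-R : ∀ x y → R (conj x) (R x y) ≡ y * N x
R-conj-R x y = solve₂ (λ X Y → (Y *ₜ X) *ₜ conjₜ X) (λ X Y → Y *ₜ (X *ₜ conjₜ X)) x y refl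

conj-+ : ∀ x y → conj (x + y) ≡ conj x + conj y
conj-+ x y = solve₂ (λ X Y → conjₜ (X +ₜ Y)) (λ X Y → conjₜ X +ₜ conjₜ Y) x y refl

conj-neg : ∀ x → conj (- x) ≡ - conj x
conj-neg x = solve₁ (λ X → conjₜ (-ₜ X)) (λ X → -ₜ conjₜ X) x refl

conj-* : ∀ x y → conj (x * y) ≡ conj y * conj x
conj-* x y = solve₂ (λ X Y → conjₜ (X *ₜ Y)) (λ X Y → conjₜ Y *ₜ conjₜ X) x y refl

conj-InO : ∀ {x} → InO x → InO (conj x)
conj-InO gen₁ = add∈ (neg∈ one∈) (neg∈ gen₁)
conj-InO gen₂ = add∈ (neg∈ one∈) (neg∈ gen₂)
conj-InO gen₄ = add∈ (neg∈ one∈) (neg∈ gen₄)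
conj-InO one∈ = one∈
conj-InO (add∈ {x} {y} x∈O y∈O) = subst InO (sym (conj-+ x y)) (add∈ (conj-InO x∈O) (conj-InO y∈O))
conj-InO (neg∈ {x} x∈O)         = subst InO (sym (conj-neg x)) (neg∈ (conj-InO x∈O))
conj-InO (mul∈ {x} {y} x∈O y∈O) = subst InO (sym (conj-* x y)) (mul∈ (conj-InO y∈O) (conj-InO x∈O))

module Unit (u : 𝕆) (Nu≡one : N u ≡ one) where

  open ≡-Reasoning

  private
    ū : 𝕆
    ū = conj u

  L-L-conj-unit : ∀ t → L u (L ū t) ≡ t
  L-L-conj-unit t = trans (L-L-conj u t) (trans (cong (_* t) Nu≡one) (*-identityˡ t))

  L-conj-L-unit : ∀ t → L ū (L u t) ≡ t
  L-conj-L-unit t = trans (L-conj-L u t) (trans (cong (_* t) Nu≡one) (*-identityˡ t))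

  R-R-conj-unit : ∀ t → R u (R ū t) ≡ t
  R-R-conj-unit t = trans (R-R-conj u t) (trans (cong (t *_) Nu≡one) (*-identityʳ t))

  R-conj-R-unit : ∀ t → R ū (R u t) ≡ t
  R-conj-R-unit t = trans (R-conj-R u t) (trans (cong (t *_) Nu≡one) (*-identityʳ t))

  B-B-conj-unit : ∀ t → B u (B ū t) ≡ t
  B-B-conj-unit t = begin
    (u * ((ū * t) * ū)) * u   ≡⟨ cong (λ y → (u * y) * u) (*-flexible ū t) ⟩
    (u * (ū * (t * ū))) * u   ≡⟨ cong (_* u) (L-L-conj-unit (t * ū)) ⟩
    (t * ū) * u               ≡⟨ R-R-conj-unit t ⟩
    t                         ∎

≐-setoid : Setoid (lsuc 0ℓ) 0ℓ
≐-setoid = record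
  { Carrier       = Subset
  ; _≈_           = _≐_
  ; isEquivalence = record
    { refl  = λ x → id , id
    ; sym   = λ A≐C x → proj₂ (A≐C x) , proj₁ (A≐C x)
    ; trans = λ A≐C C≐D x → (λ a → proj₁ (C≐D x) (proj₁ (A≐C x) a)) , (λ d → proj₂ (A≐C x) (proj₂ (C≐D x) d))
    }
  }

image-cong : ∀ f {A C} → A ≐ C → image f A ≐ image f C
image-cong f A≐C z = (λ (y , a , e) → y , proj₁ (A≐C y) a , e) , (λ (y , c , e) → y , proj₂ (A≐C y) c , e)

image-∘ : ∀ f g A → image (λ x → f (g x)) A ≐ image f (image g A)
image-∘ f g A z =
  (λ (x , a , e) → g x , (x , a , refl) , e) ,
  (λ (y , (x , a , gx≡y) , fy≡z) → x , a , trans (cong f gx≡y) fy≡z)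

image-image-≐ : {P : Subset} {f g h : 𝕆 → 𝕆} (α β : 𝕆 → 𝕆) →
                (∀ {x} → P x → P (α x)) → (∀ {y} → P y → P (β y)) →
                (∀ x → f (g x) ≡ h (α x)) → (∀ y → α (β y) ≡ y) →
                image f (image g P) ≐ image h P
image-image-≐ {P} {f} {g} {h} α β α-pres β-pres f∘g≗h∘α α∘β≗id z = to , from
  where
  to : image f (image g P) z → image h P z
  to (y , (x , x∈P , gx≡y) , fy≡z) =
    α x , α-pres x∈P , trans (sym (f∘g≗h∘α x)) (trans (cong f gx≡y) fy≡z)

  from : image h P z → image f (image g P) z
  from (y , y∈P , hy≡z) =
    g (β y) , (β y , β-pres y∈P , refl) , trans (f∘g≗h∘α (β y)) (trans (cong h (α∘β≗id y)) hy≡z)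

module Translations {u : 𝕆} (u∈O : InO u) (Nu≡one : N u ≡ one) where

  open Unit u Nu≡one

  private
    ū : 𝕆
    ū = conj u

    ū∈O : InO ū
    ū∈O = conj-InO u∈O

    B-InO : ∀ {v x} → InO v → InO x → InO (B v x)
    B-InO v∈O x∈O = mul∈ (mul∈ v∈O x∈O) v∈O

  L-image-Os : ∀ s → image (L u) (Os s) ≐ Os (L ū s)
  L-image-Os s = image-image-≐ (B u) (B ū) (B-InO u∈O) (B-InO ū∈O) key B-B-conj-unit
    where
    open ≡-Reasoning
    key : ∀ x → u * (x * s) ≡ B u x * (ū * s)
    key x = begin
      u * (x * s)                   ≡⟨ cong (λ t → u * (x * t)) (L-L-conj-unit s) ⟨
      u * (x * (u * (ū * s)))       ≡⟨ *-leftBol u x (ū * s) ⟩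
      (u * (x * u)) * (ū * s)       ≡⟨ cong (_* (ū * s)) (*-flexible u x) ⟨
      B u x * (ū * s)               ∎

  R-image-Os : ∀ s → image (R u) (Os s) ≐ Os (B u s)
  R-image-Os s = image-image-≐ (R ū) (R u) (λ x∈O → mul∈ x∈O ū∈O) (λ y∈O → mul∈ y∈O u∈O) key R-conj-R-unit
    where
    open ≡-Reasoning
    key : ∀ x → (x * s) * u ≡ (x * ū) * B u s
    key x = begin
      (x * s) * u                   ≡⟨ cong (λ t → (t * s) * u) (R-R-conj-unit x) ⟨
      (((x * ū) * u) * s) * u       ≡⟨ *-rightBol u s (x * ū) ⟩
      (x * ū) * B u s               ∎

  L-image-sO : ∀ s → image (L u) (sO s) ≐ sO (B u s)
  L-image-sO s = image-image-≐ (L ū) (L u) (mul∈ ū∈O) (mul∈ u∈O) key L-conj-L-unit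
    where
    open ≡-Reasoning
    key : ∀ x → u * (s * x) ≡ B u s * (ū * x)
    key x = begin
      u * (s * x)                   ≡⟨ cong (λ t → u * (s * t)) (L-L-conj-unit x) ⟨
      u * (s * (u * (ū * x)))       ≡⟨ *-leftBol u s (ū * x) ⟩
      (u * (s * u)) * (ū * x)       ≡⟨ cong (_* (ū * x)) (*-flexible u s) ⟨
      B u s * (ū * x)               ∎

  R-image-sO : ∀ s → image (R u) (sO s) ≐ sO (R ū s)
  R-image-sO s = image-image-≐ (B u) (B ū) (B-InO u∈O) (B-InO ū∈O) key B-B-conj-unit
    where
    open ≡-Reasoning
    key : ∀ x → (s * x) * u ≡ (s * ū) * B u x
    key x = begin
      (s * x) * u                   ≡⟨ cong (λ t → (t * x) * u) (R-R-conj-unit s) ⟨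
      (((s * ū) * u) * x) * u       ≡⟨ *-rightBol u x (s * ū) ⟩
      (s * ū) * B u x               ∎

  B-image-Os : ∀ s → image (B u) (Os s) ≐ Os (R u s)
  B-image-Os s = begin
    image (B u) (Os s)                ≈⟨ image-∘ (R u) (L u) (Os s) ⟩
    image (R u) (image (L u) (Os s))  ≈⟨ image-cong (R u) (L-image-Os s) ⟩
    image (R u) (Os (ū * s))          ≈⟨ R-image-Os (ū * s) ⟩
    Os (B u (ū * s))                  ≡⟨ cong (λ t → Os (t * u)) (L-L-conj-unit s) ⟩
    Os (R u s)                        ∎
    where open import Relation.Binary.Reasoning.Setoid ≐-setoid

  B-image-sO : ∀ s → image (B u) (sO s) ≐ sO (L u s)
  B-image-sO s = begin
    image (B u) (sO s)                ≈⟨ image-∘ (R u) (L u) (sO s) ⟩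
    image (R u) (image (L u) (sO s))  ≈⟨ image-cong (R u) (L-image-sO s) ⟩
    image (R u) (sO (B u s))          ≈⟨ R-image-sO (B u s) ⟩
    sO (R ū (B u s))                  ≡⟨ cong sO (R-conj-R-unit (u * s)) ⟩
    sO (L u s)                        ∎
    where open import Relation.Binary.Reasoning.Setoid ≐-setoid

mainTheorem9 : (u s : 𝕆) → InO u → N u ≡ one → InO s → N s ≡ two →
      (image (L u) (Os s) ≐ Os (L (conj u) s))
    × (image (R u) (Os s) ≐ Os (B u s))
    × (image (B u) (Os s) ≐ Os (R u s))
    × (image (L u) (sO s) ≐ sO (B u s))
    × (image (R u) (sO s) ≐ sO (R (conj u) s))
    × (image (B u) (sO s) ≐ sO (L u s))
mainTheorem9 u s u∈O Nu≡one _ _ =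
  L-image-Os s , R-image-Os s , B-image-Os s , L-image-sO s , R-image-sO s , B-image-sO s
  where open Translations u∈O Nu≡one
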